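{- Let $\delta\in[0,1)$, $c\geq 1$, let $a\geq 1$ and $s\geq 1$ be integers, and let $\ell\geq as$. Let $\mathcal{C}\colon\{0,1\}^{3s}\to(\{0,1\}^{c})^s$ be a code with relative distance at least $\delta$, and let $\mathsf{TC}^{(s)}\colon(\{0,1\}^s)^{(\leq s)}\to(\{0,1\}^{3s})^{(\leq s)}$ be an $s$-truncated tree code with distance at least $1/2$. Define $\mathsf{TC}^{(s)}_{\operatorname{Lag}\ell}\colon\{0,1\}^{(\leq s^2)}\to(\{0,1\}^{c})^{(\leq s^2)}$ as follows: for $x\in\{0,1\}^k$ ($k\leq s^2$), let $x'=(x'_1,\dots,x'_{\lfloor k/s\rfloor})\in(\{0,1\}^s)^{\lfloor k/s\rfloor}$ with $x'_j=x|_{[(j-1)s+1,js]}$ (leftover symbols are ignored), let $y'=\mathsf{TC}^{(s)}(x')$, and for all $i\in\{1,\dots,s\}$ and $1\leq j\leq\lfloor k/s\rfloor$ with $js+i-1\leq k$ set $\mathsf{TC}^{(s)}_{\operatorname{Lag}\ell}(x)_{js+i-1}=(\mathcal{C}(y'_j))_i$; all other positions of $\mathsf{TC}^{(s)}_{\operatorname{Lag}\ell}(x)$ (in particular positions $1,\dots,s-1$) carry the empty symbol $\varepsilon$. Then $\mathsf{TC}^{(s)}_{\operatorname{Lag}\ell}$ has (truncated) $\ell$-lagged distance at least $\delta\left(\frac12-\frac{3}{2a}\right)$, i.e. for all $k\leq s^2$ and $u\neq v\in\{0,1\}^k$ with $k-\operatorname{split}(u,v)\geq\ell$, \[\frac{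\Delta(\mathsf{TC}^{(s)}_{\operatorname{Lag}\ell}(u),\mathsf{TC}^{(s)}_{\operatorname{Lag}\ell}(v))}{k-\operatorname{split}(u,v)}\geq\delta\left(\frac12-\frac{3}{2a}\right).\]
   Context: An $s$-truncated tree code $\mathsf{TC}^{(s)}\colon\Sigma^{(\leq s)}\to\Gamma^{(\leq s)}$ maps each $x\in\Sigma^k$, $k\leq s$, to a string in $\Gamma^k$ whose $i$-th symbol depends only on $x_1,\dots,x_i$; its distance is $\inf_{k\leq s,\,x\neq x'\in\Sigma^k}\frac{\Delta(\mathsf{TC}^{(s)}(x),\mathsf{TC}^{(s)}(x'))}{k-\operatorname{split}(x,x')}$, where $\operatorname{split}(x,x')$ is the largest $t$ with $x_u=x'_u$ for all $u\leq t$ and $\Delta$ is Hamming distance. A code $\mathcal{C}\colon\{0,1\}^{3s}\to(\{0,1\}^c)^s$ has relative distance at least $\delta$ if distinct messages have encodings differing in at least $\delta s$ coordinates. Hamming distance of outputs of $\mathsf{TC}^{(s)}_{\operatorname{Lag}\ell}$ counts positions (symbols in $\{0,1\}^c\cup\{\varepsilon\}$) where they differ.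
   Formalization: The parameter δ is a rational number in [0,1), and the parameter ℓ is likewise taken rational. -}

module Defs where

open import Data.Bool using (Bool; false)
import Data.Bool.Properties as BoolP
open import Data.Nat using (ℕ; zero; suc; _+_; _*_; _∸_; _≤_; _<_; NonZero; _<?_)
open import Data.Nat.Properties
  using (≤-trans; ≤-refl; +-monoʳ-<; +-comm; *-comm; module ≤-Reasoning)
open import Data.Nat.DivMod using (_/_; _%_; m%n<n; m/n*n≤m; /-monoˡ-≤; m*n/n≡m)
open import Data.Fin using (Fin; toℕ; fromℕ<)
open import Data.Vec using (Vec; []; _∷_; lookup; tabulate)
import Data.Vec.Properties as VecP
open import Data.Maybe using (Maybe; just; nothing)
import Data.Maybe.Properties as MaybeP
open import Data.Integer using (+_)
open import Data.Rational using (ℚ)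
import Data.Rational as Q
open import Relation.Nullary using (yes; no)
open import Relation.Binary.Definitions using (DecidableEquality)
open import Relation.Binary.PropositionalEquality using (_≡_; _≢_; refl)

ℕtoℚ : ℕ → ℚ
ℕtoℚ n = (+ n) Q./ 1

Bits : ℕ → Set
Bits n = Vec Bool n

_≟Bits_ : ∀ {n} → DecidableEquality (Bits n)
_≟Bits_ = VecP.≡-dec BoolP._≟_

Δ : ∀ {A : Set} → DecidableEquality A → ∀ {k} → Vec A k → Vec A k → ℕ
Δ _≟_ []       []       = 0
Δ _≟_ (a ∷ x) (b ∷ y) with a ≟ b
... | yes _ = Δ _≟_ x y
... | no  _ = suc (Δ _≟_ x y)

split : ∀ {A : Set} → DecidableEquality A → ∀ {k} → Vec A k → Vec A k → ℕ
split _≟_ []       []       = 0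
split _≟_ (a ∷ x) (b ∷ y) with a ≟ b
... | yes _ = suc (split _≟_ x y)
... | no  _ = 0

Code : (s c : ℕ) → Set
Code s c = Bits (3 * s) → Vec (Bits c) s

HasRelDistAtLeast : ∀ {s c} → Code s c → ℚ → Set
HasRelDistAtLeast {s} {c} C δ =
  ∀ (m m' : Bits (3 * s)) → m ≢ m' →
    δ Q.* ℕtoℚ s Q.≤ ℕtoℚ (Δ _≟Bits_ (C m) (C m'))

TruncMap : (s : ℕ) → Set
TruncMap s = ∀ {k} → k ≤ s → Vec (Bits s) k → Vec (Bits (3 * s)) k

-- the i-th output symbol depends only on x_1 … x_i
IsOnline : ∀ {s} → TruncMap s → Set
IsOnline {s} TC =
  ∀ {k k'} (pk : k ≤ s) (pk' : k' ≤ s)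
    (x : Vec (Bits s) k) (x' : Vec (Bits s) k') (i : Fin k) (i' : Fin k') →
    toℕ i ≡ toℕ i' →
    (∀ (j : Fin k) (j' : Fin k') → toℕ j ≡ toℕ j' → toℕ j ≤ toℕ i →
        lookup x j ≡ lookup x' j') →
    lookup (TC pk x) i ≡ lookup (TC pk' x') i'

-- distance: inf over k ≤ s and x ≠ x' ∈ Σ^k of Δ(TC x, TC x')/(k − split(x,x'))
-- is at least d  (equivalently, every such ratio is ≥ d; k − split > 0 here)
HasTreeDistAtLeast : ∀ {s} → TruncMap s → ℚ → Set
HasTreeDistAtLeast {s} TC d =
  ∀ {k} (pk : k ≤ s) (x x' : Vec (Bits s) k) → x ≢ x' →
    d Q.* ℕtoℚ (k ∸ split _≟Bits_ x x')
      Q.≤ ℕtoℚ (Δ _≟Bits_ (TC pk x) (TC pk x'))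

record TruncatedTreeCode (s : ℕ) : Set where
  field
    map    : TruncMap s
    online : IsOnline map

-- The lagged construction TC^(s)_{Lag ℓ} : {0,1}^(≤ s²) → ({0,1}^c ∪ {ε})^(≤ s²)
-- (ε is represented by nothing)

module _ (s : ℕ) .{{_ : NonZero s}} where

  div-le : ∀ {k} → k ≤ s * s → k / s ≤ s
  div-le {k} k≤ = ≤-trans (/-monoˡ-≤ s k≤) (≤-refl' (m*n/n≡m s s))
    where ≤-refl' : ∀ {a b} → a ≡ b → a ≤ b
          ≤-refl' refl = ≤-refl

  chunk-lt : ∀ {k} (j : Fin (k / s)) (i : Fin s) → toℕ j * s + toℕ i < k
  chunk-lt {k} j i = begin-strict
      toℕ j * s + toℕ i  <⟨ +-monoʳ-< (toℕ j * s) (Data.Fin.Properties.toℕ<n i) ⟩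
      toℕ j * s + s      ≡⟨ +-comm (toℕ j * s) s ⟩
      suc (toℕ j) * s    ≤⟨ Data.Nat.Properties.*-monoˡ-≤ s (Data.Fin.Properties.toℕ<n j) ⟩
      (k / s) * s        ≤⟨ m/n*n≤m k s ⟩
      k                  ∎
    where open ≤-Reasoning
          import Data.Fin.Properties

  -- x'_j = x|[(j−1)s+1, js]   (1 ≤ j ≤ ⌊k/s⌋; written 0-indexed), leftovers ignored
  blocks : ∀ {k} → Bits k → Vec (Bits s) (k / s)
  blocks {k} x = tabulate λ j → tabulate λ i →
    lookup x (fromℕ< (chunk-lt j i))

  -- output position p (1-indexed) carries (C(y'_j))_i when p = js + i − 1 with
  -- 1 ≤ i ≤ s and 1 ≤ j ≤ ⌊k/s⌋ (then j = ⌊p/s⌋, i − 1 = p mod s); else ε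
  lagSymbol : ∀ {c k} → Code s c → Vec (Bits (3 * s)) (k / s) → ℕ → Maybe (Bits c)
  lagSymbol {c} {k} C y' p with p / s
  ... | zero  = nothing
  ... | suc j with j <? k / s
  ...   | yes j< = just (lookup (C (lookup y' (fromℕ< j<))) (fromℕ< (m%n<n p s)))
  ...   | no  _  = nothing

  Lag : ∀ {c} → Code s c → TruncatedTreeCode s →
        ∀ {k} → k ≤ s * s → Bits k → Vec (Maybe (Bits c)) k
  Lag C TC {k} k≤ x =
    let y' = TruncatedTreeCode.map TC (div-le k≤) (blocks x)
    in tabulate λ q → lagSymbol C y' (suc (toℕ q))

_≟Sym_ : ∀ {c} → DecidableEquality (Maybe (Bits c))
_≟Sym_ = MaybeP.≡-dec _≟Bits_

-- (truncated) ℓ-lagged distance at least d for a map {0,1}^(≤ s²) → Γ^(≤ s²):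
-- for all k ≤ s² and u ≠ v ∈ {0,1}^k with k − split(u,v) ≥ ℓ,
--   Δ(F u, F v) / (k − split(u,v)) ≥ d   (stated multiplied out; k − split > 0)
HasLaggedDistAtLeast : ∀ (s : ℕ) {Γ : Set} → DecidableEquality Γ →
  (∀ {k} → k ≤ s * s → Bits k → Vec Γ k) → (ℓ d : ℚ) → Set
HasLaggedDistAtLeast s _≟Γ_ F ℓ d =
  ∀ {k} (k≤ : k ≤ s * s) (u v : Bits k) → u ≢ v →
    ℓ Q.≤ ℕtoℚ (k ∸ split BoolP._≟_ u v) →
    d Q.* ℕtoℚ (k ∸ split BoolP._≟_ u v) Q.≤ ℕtoℚ (Δ _≟Γ_ (F k≤ u) (F k≤ v))

module Submission where

-- Let p = split(u, v) and m = k − p ≥ ℓ ≥ a s. The first differing bit lies in block ⌊p/s⌋, so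
-- the block strings split no later than there, and tree distance ½ gives at least
-- (⌊k/s⌋ − ⌊p/s⌋)/2 ≥ (m/s − 1)/2 differing tree-code symbols. All of them but the last have
-- their C-encodings inside the first k output positions, so at least N ≥ (m/s − 3)/2 symbols
-- each contribute δ s differing output positions. Hence Δ ≥ δ s N ≥ δ (m/2 − 3s/2), and
-- s ≤ m/a turns this into δ (½ − 3/(2a)) m.

open import Defs

module FiniteSums where

  open import Data.Nat using (ℕ; zero; suc; _+_; _*_; _∸_; _≤_; _<_; z≤n; s≤s)
  open import Data.Nat.Properties
  open import Relation.Binary.PropositionalEquality

  sumBelow : ℕ → (ℕ → ℕ) → ℕ
  sumBelow zero    f = 0
  sumBelow (suc n) f = f 0 + sumBelow n (λ q → f (suc q))

  syntax sumBelow n (λ q → e) = ∑[ q < n ] e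

  sumBelow-+ : ∀ m n f → sumBelow (m + n) f ≡ sumBelow m f + ∑[ q < n ] f (m + q)
  sumBelow-+ zero    n f = refl
  sumBelow-+ (suc m) n f = begin
    f 0 + sumBelow (m + n) (λ q → f (suc q))                        ≡⟨ cong (f 0 +_) (sumBelow-+ m n (λ q → f (suc q))) ⟩
    f 0 + (sumBelow m (λ q → f (suc q)) + ∑[ q < n ] f (suc m + q)) ≡⟨ +-assoc (f 0) _ _ ⟨
    sumBelow (suc m) f + ∑[ q < n ] f (suc m + q)                   ∎
    where open ≡-Reasoning

  sumBelow-cong : ∀ n {f g} → (∀ q → q < n → f q ≡ g q) → sumBelow n f ≡ sumBelow n g
  sumBelow-cong zero    f≡g = refl
  sumBelow-cong (suc n) f≡g = cong₂ _+_ (f≡g 0 (s≤s z≤n)) (sumBelow-cong n (λ q q<n → f≡g (suc q) (s≤s q<n)))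

  sumBelow-≤-* : ∀ n f {b} → (∀ q → f q ≤ b) → sumBelow n f ≤ n * b
  sumBelow-≤-* zero    f f≤b = z≤n
  sumBelow-≤-* (suc n) f f≤b = +-mono-≤ (f≤b 0) (sumBelow-≤-* n (λ q → f (suc q)) (λ q → f≤b (suc q)))

  sumBelow-window : ∀ o n {k} f → o + n ≤ k → ∑[ q < n ] f (o + q) ≤ sumBelow k f
  sumBelow-window o n {k} f o+n≤k = begin
    ∑[ q < n ] f (o + q)                                    ≤⟨ m≤n+m _ _ ⟩
    sumBelow o f + ∑[ q < n ] f (o + q)                     ≡⟨ sumBelow-+ o n f ⟨
    sumBelow (o + n) f                                      ≤⟨ m≤m+n _ _ ⟩
    sumBelow (o + n) f + ∑[ q < k ∸ (o + n) ] f (o + n + q) ≡⟨ sumBelow-+ (o + n) (k ∸ (o + n)) f ⟨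
    sumBelow (o + n + (k ∸ (o + n))) f                      ≡⟨ cong (λ l → sumBelow l f) (m+[n∸m]≡n o+n≤k) ⟩
    sumBelow k f                                            ∎
    where open ≤-Reasoning

  sumBelow-blocks : ∀ t s f → sumBelow (t * s) f ≡ ∑[ j < t ] ∑[ i < s ] f (j * s + i)
  sumBelow-blocks zero    s f = refl
  sumBelow-blocks (suc t) s f = begin
    sumBelow (s + t * s) f                                   ≡⟨ sumBelow-+ s (t * s) f ⟩
    sumBelow s f + sumBelow (t * s) (λ q → f (s + q))        ≡⟨ cong (sumBelow s f +_) (sumBelow-blocks t s (λ q → f (s + q))) ⟩
    sumBelow s f + ∑[ j < t ] ∑[ i < s ] f (s + (j * s + i)) ≡⟨ cong (sumBelow s f +_) (sumBelow-cong t (λ j _ →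
                                                                   sumBelow-cong s (λ i _ → cong f (+-assoc s (j * s) i)))) ⟨
    sumBelow s f + ∑[ j < t ] ∑[ i < s ] f (s + j * s + i)   ∎
    where open ≡-Reasoning

open FiniteSums

module HammingDistance where

  open import Data.Fin as Fin using (Fin; toℕ; fromℕ<)
  open import Data.Maybe using (just)
  import Data.Maybe.Properties as MaybeP
  open import Data.Nat using (ℕ; zero; suc; _≤_; _<_; z≤n; s≤s)
  open import Data.Product using (∃; _×_; _,_)
  open import Data.Vec using (Vec; []; _∷_; lookup; tabulate)
  open import Relation.Nullary using (yes; no; contradiction)
  open import Relation.Binary.Definitions using (DecidableEquality)
  open import Relation.Binary.PropositionalEquality

  lookupOr : ∀ {A : Set} {n} → Vec A n → A → ℕ → A
  lookupOr []      d _       = d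
  lookupOr (x ∷ v) d zero    = x
  lookupOr (x ∷ v) d (suc q) = lookupOr v d q

  lookupOr-fromℕ< : ∀ {A : Set} {n} (v : Vec A n) d {q} (q<n : q < n) → lookup v (fromℕ< q<n) ≡ lookupOr v d q
  lookupOr-fromℕ< (x ∷ v) d {zero}  q<n       = refl
  lookupOr-fromℕ< (x ∷ v) d {suc q} (s≤s q<n) = lookupOr-fromℕ< v d q<n

  module _ {A : Set} (_≟_ : DecidableEquality A) where

    mismatch : A → A → ℕ
    mismatch x y with x ≟ y
    ... | yes _ = 0
    ... | no  _ = 1

    mismatch≤1 : ∀ x y → mismatch x y ≤ 1
    mismatch≤1 x y with x ≟ y
    ... | yes _ = z≤n
    ... | no  _ = s≤s z≤n

    Δ-lookupOr : ∀ {n} (x y : Vec A n) d → Δ _≟_ x y ≡ ∑[ q < n ] mismatch (lookupOr x d q) (lookupOr y d q)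
    Δ-lookupOr []      []      d = refl
    Δ-lookupOr (a ∷ x) (b ∷ y) d with a ≟ b
    ... | yes _ = Δ-lookupOr x y d
    ... | no  _ = cong suc (Δ-lookupOr x y d)

    Δ-tabulate : ∀ n (f g : ℕ → A) →
      Δ _≟_ (tabulate {n = n} (λ q → f (toℕ q))) (tabulate (λ q → g (toℕ q))) ≡ ∑[ q < n ] mismatch (f q) (g q)
    Δ-tabulate zero    f g = refl
    Δ-tabulate (suc n) f g with f 0 ≟ g 0
    ... | yes _ = Δ-tabulate n (λ q → f (suc q)) (λ q → g (suc q))
    ... | no  _ = cong suc (Δ-tabulate n (λ q → f (suc q)) (λ q → g (suc q)))

    split-first-difference : ∀ {k} (u v : Vec A k) → u ≢ v →
      ∃ λ (i : Fin k) → toℕ i ≡ split _≟_ u v × lookup u i ≢ lookup v i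
    split-first-difference []      []      u≢v = contradiction refl u≢v
    split-first-difference (a ∷ x) (b ∷ y) u≢v with a ≟ b
    ... | no  a≢b  = Fin.zero , refl , a≢b
    ... | yes refl with split-first-difference x y (λ x≡y → u≢v (cong (a ∷_) x≡y))
    ...   | i , i≡split , xᵢ≢yᵢ = Fin.suc i , cong suc i≡split , xᵢ≢yᵢ

    split≤difference : ∀ {k} (u v : Vec A k) (j : Fin k) → lookup u j ≢ lookup v j → split _≟_ u v ≤ toℕ j
    split≤difference (a ∷ x) (b ∷ y) j uⱼ≢vⱼ with a ≟ b
    split≤difference (a ∷ x) (b ∷ y) Fin.zero    uⱼ≢vⱼ | yes a≡b = contradiction a≡b uⱼ≢vⱼ
    split≤difference (a ∷ x) (b ∷ y) (Fin.suc j) uⱼ≢vⱼ | yes _   = s≤s (split≤difference x y j uⱼ≢vⱼ)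
    ... | no _ = z≤n

    split≤length : ∀ {k} (u v : Vec A k) → split _≟_ u v ≤ k
    split≤length []      []      = z≤n
    split≤length (a ∷ x) (b ∷ y) with a ≟ b
    ... | yes _ = s≤s (split≤length x y)
    ... | no  _ = z≤n

  mismatch-just : ∀ {A : Set} (_≟_ : DecidableEquality A) x y →
    mismatch (MaybeP.≡-dec _≟_) (just x) (just y) ≡ mismatch _≟_ x y
  mismatch-just _≟_ x y with x ≟ y
  ... | yes _ = refl
  ... | no  _ = refl

open HammingDistance

module NaturalsInRationals where

  open import Data.Integer as ℤ using (+_; +≤+)
  import Data.Integer.Properties as ℤP
  open import Data.Nat as ℕ using (ℕ; zero; suc)
  open import Data.Nat.Coprimality using (1-coprimeTo)
  import Data.Nat.Coprimality as Coprimality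
  open import Data.Rational as ℚ using (ℚ; mkℚ; toℚᵘ; _+_; _*_; _-_; -_; _≤_; ½; 1ℚ; Positive)
  open import Data.Rational.Properties
  import Data.Rational.Unnormalised as ℚᵘ
  import Data.Rational.Unnormalised.Properties as ℚᵘP
  open import Relation.Binary.PropositionalEquality
  import Data.Integer.Solver
  import Data.Nat.Solver
  import Data.Rational.Solver

  ℕtoℚ≡mkℚ : ∀ n → ℕtoℚ n ≡ mkℚ (+ n) 0 (Coprimality.sym (1-coprimeTo n))
  ℕtoℚ≡mkℚ n = normalize-coprime _

  toℚᵘ-ℕtoℚ : ∀ n → toℚᵘ (ℕtoℚ n) ≡ ℚᵘ.mkℚᵘ (+ n) 0
  toℚᵘ-ℕtoℚ n rewrite ℕtoℚ≡mkℚ n = refl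

  ℕtoℚ-+ : ∀ m n → ℕtoℚ (m ℕ.+ n) ≡ ℕtoℚ m + ℕtoℚ n
  ℕtoℚ-+ m n = toℚᵘ-injective (ℚᵘP.≃-trans homo (ℚᵘP.≃-sym (toℚᵘ-homo-+ (ℕtoℚ m) (ℕtoℚ n))))
    where
    open Data.Integer.Solver.+-*-Solver
    homo : toℚᵘ (ℕtoℚ (m ℕ.+ n)) ℚᵘ.≃ toℚᵘ (ℕtoℚ m) ℚᵘ.+ toℚᵘ (ℕtoℚ n)
    homo rewrite toℚᵘ-ℕtoℚ (m ℕ.+ n) | toℚᵘ-ℕtoℚ m | toℚᵘ-ℕtoℚ n =
      ℚᵘ.*≡* (trans (cong (ℤ._* + 1) (ℤP.pos-+ m n))
        (solve 2 (λ m n → (m :+ n) :* con (+ 1) := (m :* con (+ 1) :+ n :* con (+ 1)) :* con (+ 1)) refl (+ m) (+ n)))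

  ℕtoℚ-* : ∀ m n → ℕtoℚ (m ℕ.* n) ≡ ℕtoℚ m * ℕtoℚ n
  ℕtoℚ-* m n = toℚᵘ-injective (ℚᵘP.≃-trans homo (ℚᵘP.≃-sym (toℚᵘ-homo-* (ℕtoℚ m) (ℕtoℚ n))))
    where
    homo : toℚᵘ (ℕtoℚ (m ℕ.* n)) ℚᵘ.≃ toℚᵘ (ℕtoℚ m) ℚᵘ.* toℚᵘ (ℕtoℚ n)
    homo rewrite toℚᵘ-ℕtoℚ (m ℕ.* n) | toℚᵘ-ℕtoℚ m | toℚᵘ-ℕtoℚ n = ℚᵘ.*≡* (cong (ℤ._* + 1) (ℤP.pos-* m n))

  ℕtoℚ-mono-≤ : ∀ {m n} → m ℕ.≤ n → ℕtoℚ m ≤ ℕtoℚ n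
  ℕtoℚ-mono-≤ {m} {n} m≤n rewrite ℕtoℚ≡mkℚ m | ℕtoℚ≡mkℚ n =
    ℚ.*≤* (subst₂ ℤ._≤_ (sym (ℤP.*-identityʳ (+ m))) (sym (ℤP.*-identityʳ (+ n))) (+≤+ m≤n))

  ℕtoℚ-cancel-≤ : ∀ {m n} → ℕtoℚ m ≤ ℕtoℚ n → m ℕ.≤ n
  ℕtoℚ-cancel-≤ {m} {n} m≤n rewrite ℕtoℚ≡mkℚ m | ℕtoℚ≡mkℚ n with m≤n
  ... | ℚ.*≤* m*1≤n*1 = ℤP.drop‿+≤+ (subst₂ ℤ._≤_ (ℤP.*-identityʳ (+ m)) (ℤP.*-identityʳ (+ n)) m*1≤n*1)

  ℕtoℚ-suc-positive : ∀ n → Positive (ℕtoℚ (suc n))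
  ℕtoℚ-suc-positive n rewrite ℕtoℚ≡mkℚ (suc n) = _

  sumBelow-scale-≤ : ∀ (x : ℚ) t f g → (∀ j → j ℕ.< t → ℕtoℚ (f j) * x ≤ ℕtoℚ (g j)) →
    ℕtoℚ (sumBelow t f) * x ≤ ℕtoℚ (sumBelow t g)
  sumBelow-scale-≤ x zero    f g fx≤g = ≤-reflexive (*-zeroˡ x)
  sumBelow-scale-≤ x (suc t) f g fx≤g = begin
    ℕtoℚ (f 0 ℕ.+ sumBelow t f′) * x          ≡⟨ cong (_* x) (ℕtoℚ-+ (f 0) _) ⟩
    (ℕtoℚ (f 0) + ℕtoℚ (sumBelow t f′)) * x   ≡⟨ *-distribʳ-+ x (ℕtoℚ (f 0)) _ ⟩
    ℕtoℚ (f 0) * x + ℕtoℚ (sumBelow t f′) * x ≤⟨ +-mono-≤ (fx≤g 0 (ℕ.s≤s ℕ.z≤n)) (sumBelow-scale-≤ x t f′ g′ (λ j j<t → fx≤g (suc j) (ℕ.s≤s j<t))) ⟩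
    ℕtoℚ (g 0) + ℕtoℚ (sumBelow t g′)         ≡⟨ ℕtoℚ-+ (g 0) _ ⟨
    ℕtoℚ (g 0 ℕ.+ sumBelow t g′)              ∎
    where
    open ≤-Reasoning
    f′ g′ : ℕ → ℕ
    f′ j = f (suc j)
    g′ j = g (suc j)

  ½*-≤⇒≤-double : ∀ n d → ½ * ℕtoℚ n ≤ ℕtoℚ d → n ℕ.≤ d ℕ.+ d
  ½*-≤⇒≤-double n d ½n≤d = ℕtoℚ-cancel-≤ (begin
    ℕtoℚ n                  ≡⟨ solve 1 (λ x → x := con ½ :* x :+ con ½ :* x) refl (ℕtoℚ n) ⟩
    ½ * ℕtoℚ n + ½ * ℕtoℚ n ≤⟨ +-mono-≤ ½n≤d ½n≤d ⟩
    ℕtoℚ d + ℕtoℚ d         ≡⟨ ℕtoℚ-+ d d ⟨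
    ℕtoℚ (d ℕ.+ d)          ∎)
    where
    open ≤-Reasoning
    open Data.Rational.Solver.+-*-Solver

  [1/n]*n≡1 : ∀ n .{{_ : ℕ.NonZero n}} → (+ 1) ℚ./ n * ℕtoℚ n ≡ 1ℚ
  [1/n]*n≡1 (suc n) = toℚᵘ-injective (ℚᵘP.≃-trans (toℚᵘ-homo-* ((+ 1) ℚ./ suc n) (ℕtoℚ (suc n))) homo)
    where
    open Data.Nat.Solver.+-*-Solver
    homo : toℚᵘ ((+ 1) ℚ./ suc n) ℚᵘ.* toℚᵘ (ℕtoℚ (suc n)) ℚᵘ.≃ toℚᵘ 1ℚ
    homo rewrite toℚᵘ-ℕtoℚ (suc n) | normalize-coprime {1} {n} (1-coprimeTo (suc n)) =
      ℚᵘ.*≡* (cong ℤ.+[1+_] (solve 1 (λ n → (n :+ con 0) :* con 1 := n :* con 1 :+ con 0) refl n))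

  rate-bound : ∀ a .{{_ : ℕ.NonZero a}} m M → a ℕ.* m ℕ.≤ M ℕ.* (a ℕ.+ a) ℕ.+ 3 ℕ.* m →
    (½ - (+ 3) ℚ./ 2 * ((+ 1) ℚ./ a)) * ℕtoℚ m ≤ ℕtoℚ M
  rate-bound a@(suc a-1) m M am≤2aM+3m = *-cancelʳ-≤-pos (ℕtoℚ (a ℕ.+ a)) {{ℕtoℚ-suc-positive (a-1 ℕ.+ a)}} (begin
    (½ - t * r) * m′ * ℕtoℚ (a ℕ.+ a)          ≡⟨ cong ((½ - t * r) * m′ *_) (ℕtoℚ-+ a a) ⟩
    (½ - t * r) * m′ * (a′ + a′)               ≡⟨ solve 5 (λ h t r m a → (h :- t :* r) :* m :* (a :+ a) := (h :+ h) :* a :* m :- (t :+ t) :* (r :* a) :* m) refl ½ t r m′ a′ ⟩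
    -- ½ + ½ and t + t compute to 1ℚ and ℕtoℚ 3.
    (½ + ½) * a′ * m′ - (t + t) * (r * a′) * m′ ≡⟨ cong (λ x → (½ + ½) * a′ * m′ - ℕtoℚ 3 * x * m′) ([1/n]*n≡1 a) ⟩
    1ℚ * a′ * m′ - ℕtoℚ 3 * 1ℚ * m′            ≡⟨ solve 3 (λ a m t → con 1ℚ :* a :* m :- t :* con 1ℚ :* m := a :* m :- t :* m) refl a′ m′ (ℕtoℚ 3) ⟩
    a′ * m′ - ℕtoℚ 3 * m′                      ≤⟨ +-monoˡ-≤ (- (ℕtoℚ 3 * m′)) am≤2aM+3m′ ⟩
    ℕtoℚ M * ℕtoℚ (a ℕ.+ a) + ℕtoℚ 3 * m′ - ℕtoℚ 3 * m′
                                               ≡⟨ solve 2 (λ x y → x :+ y :- y := x) refl (ℕtoℚ M * ℕtoℚ (a ℕ.+ a)) (ℕtoℚ 3 * m′) ⟩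
    ℕtoℚ M * ℕtoℚ (a ℕ.+ a)                    ∎)
    where
    open ≤-Reasoning
    open Data.Rational.Solver.+-*-Solver
    t r a′ m′ : ℚ
    t = (+ 3) ℚ./ 2
    r = (+ 1) ℚ./ a
    a′ = ℕtoℚ a
    m′ = ℕtoℚ m
    am≤2aM+3m′ : a′ * m′ ≤ ℕtoℚ M * ℕtoℚ (a ℕ.+ a) + ℕtoℚ 3 * m′
    am≤2aM+3m′ = subst₂ _≤_ (ℕtoℚ-* a m)
      (trans (ℕtoℚ-+ (M ℕ.* (a ℕ.+ a)) (3 ℕ.* m)) (cong₂ _+_ (ℕtoℚ-* M (a ℕ.+ a)) (ℕtoℚ-* 3 m)))
      (ℕtoℚ-mono-≤ am≤2aM+3m)

open NaturalsInRationals

module LaggedTreeCode where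

  open import Data.Bool using (false)
  import Data.Bool.Properties as BoolP
  open import Data.Fin using (Fin; toℕ; fromℕ<)
  import Data.Fin.Properties as FinP
  open import Data.Maybe using (Maybe; just)
  open import Data.Nat using (ℕ; suc; pred; _+_; _*_; _∸_; _≤_; _<_; z≤n; s≤s; NonZero; >-nonZero)
  open import Data.Nat.DivMod
  open import Data.Nat.Properties
  open import Data.Product using (_×_; _,_; proj₁; proj₂)
  open import Data.Rational as ℚ using (½)
  import Data.Rational.Properties as ℚP
  open import Data.Vec using (Vec; lookup; tabulate; replicate)
  import Data.Vec.Properties as VecP
  open import Relation.Nullary using (yes; no; contradiction)
  open import Relation.Binary.PropositionalEquality
  import Data.Nat.Solver

  mismatch*δs≤Δ-code : ∀ {s c} (C : Code s c) δ → HasRelDistAtLeast C δ → ∀ y y′ →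
    ℕtoℚ (mismatch _≟Bits_ y y′) ℚ.* (δ ℚ.* ℕtoℚ s) ℚ.≤ ℕtoℚ (Δ _≟Bits_ (C y) (C y′))
  mismatch*δs≤Δ-code {s} C δ C-dist y y′ with y ≟Bits y′
  ... | yes _   = subst (ℚ._≤ ℕtoℚ (Δ _≟Bits_ (C y) (C y′))) (sym (ℚP.*-zeroˡ (δ ℚ.* ℕtoℚ s)))
                    (ℕtoℚ-mono-≤ {0} {Δ _≟Bits_ (C y) (C y′)} z≤n)
  ... | no y≢y′ = subst (ℚ._≤ ℕtoℚ (Δ _≟Bits_ (C y) (C y′))) (sym (ℚP.*-identityˡ (δ ℚ.* ℕtoℚ s))) (C-dist y y′ y≢y′)


  am≤2asN+3m : ∀ a s m N → a * s ≤ m → m ≤ (3 + (N + N)) * s → a * m ≤ s * N * (a + a) + 3 * m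
  am≤2asN+3m a s m N as≤m m≤[3+2N]s = begin
    a * m                         ≤⟨ *-monoʳ-≤ a m≤[3+2N]s ⟩
    a * ((3 + (N + N)) * s)       ≡⟨ solve 3 (λ a s N → a :* ((con 3 :+ (N :+ N)) :* s) := s :* N :* (a :+ a) :+ con 3 :* (a :* s)) refl a s N ⟩
    s * N * (a + a) + 3 * (a * s) ≤⟨ +-monoʳ-≤ (s * N * (a + a)) (*-monoʳ-≤ 3 as≤m) ⟩
    s * N * (a + a) + 3 * m       ∎
    where
    open ≤-Reasoning
    open Data.Nat.Solver.+-*-Solver

  module _ (s : ℕ) .{{_ : NonZero s}} where

    lookup-blocks : ∀ {k} (x : Bits k) j r → lookup (lookup (blocks s x) j) r ≡ lookup x (fromℕ< (chunk-lt s j r))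
    lookup-blocks x j r = trans (cong (λ row → lookup row r) (VecP.lookup∘tabulate _ j)) (VecP.lookup∘tabulate _ r)

    blocks-≢ : ∀ {k} (u v : Bits k) (i : Fin k) (i/s<k/s : toℕ i / s < k / s) → lookup u i ≢ lookup v i →
      lookup (blocks s u) (fromℕ< i/s<k/s) ≢ lookup (blocks s v) (fromℕ< i/s<k/s)
    blocks-≢ u v i i/s<k/s uᵢ≢vᵢ rows≡ = uᵢ≢vᵢ (begin
      lookup u i                           ≡⟨ cong (lookup u) i′≡i ⟨
      lookup u i′                          ≡⟨ lookup-blocks u row col ⟨
      lookup (lookup (blocks s u) row) col ≡⟨ cong (λ B → lookup B col) rows≡ ⟩
      lookup (lookup (blocks s v) row) col ≡⟨ lookup-blocks v row col ⟩
      lookup v i′                          ≡⟨ cong (lookup v) i′≡i ⟩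
      lookup v i                           ∎)
      where
      open ≡-Reasoning
      row = fromℕ< i/s<k/s
      col = fromℕ< (m%n<n (toℕ i) s)
      i′ = fromℕ< (chunk-lt s row col)
      i′≡i : i′ ≡ i
      i′≡i = FinP.toℕ-injective (begin
        toℕ i′                        ≡⟨ FinP.toℕ-fromℕ< (chunk-lt s row col) ⟩
        toℕ row * s + toℕ col         ≡⟨ cong₂ (λ q r → q * s + r) (FinP.toℕ-fromℕ< i/s<k/s) (FinP.toℕ-fromℕ< (m%n<n (toℕ i) s)) ⟩
        toℕ i / s * s + toℕ i % s     ≡⟨ +-comm (toℕ i / s * s) (toℕ i % s) ⟩
        toℕ i % s + toℕ i / s * s     ≡⟨ m≡m%n+[m/n]*n (toℕ i) s ⟨
        toℕ i                         ∎)

    +s≤⇒/s< : ∀ {p k} → p + s ≤ k → p / s < k / s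
    +s≤⇒/s< {p} {k} p+s≤k = begin-strict
      p / s                 <⟨ n<1+n (p / s) ⟩
      suc (p / s)           ≡⟨ cong (λ q → suc (q / s)) (m+n∸n≡m p s) ⟨
      suc ((p + s ∸ s) / s) ≡⟨ m/n≡1+[m∸n]/n (m≤n+m s p) ⟨
      (p + s) / s           ≤⟨ /-monoˡ-≤ s p+s≤k ⟩
      k / s                 ∎
      where open ≤-Reasoning

    k∸p<[1+k/s∸j]*s : ∀ {k p j} → j * s ≤ p → j ≤ k / s → k ∸ p < suc (k / s ∸ j) * s
    k∸p<[1+k/s∸j]*s {k} {p} {j} js≤p j≤k/s = ≤-<-trans (∸-monoʳ-≤ k js≤p)
      (m<n+o⇒m∸n<o k (j * s) {{m*n≢0 (suc (k / s ∸ j)) s}} (begin-strict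
        k                           ≡⟨ m≡m%n+[m/n]*n k s ⟩
        k % s + k / s * s           <⟨ +-monoˡ-< (k / s * s) (m%n<n k s) ⟩
        s + k / s * s               ≡⟨ cong (λ q → s + q * s) (m∸n+n≡m j≤k/s) ⟨
        s + (k / s ∸ j + j) * s     ≡⟨ solve 3 (λ s q j → s :+ (q :+ j) :* s := j :* s :+ (s :+ q :* s)) refl s (k / s ∸ j) j ⟩
        j * s + suc (k / s ∸ j) * s ∎))
      where
      open ≤-Reasoning
      open Data.Nat.Solver.+-*-Solver

    blocks-split-bound : ∀ {k} (u v : Bits k) → u ≢ v → s ≤ k ∸ split BoolP._≟_ u v →
      blocks s u ≢ blocks s v × split _≟Bits_ (blocks s u) (blocks s v) * s ≤ split BoolP._≟_ u v
    blocks-split-bound {k} u v u≢v s≤k∸split with split-first-difference BoolP._≟_ u v u≢v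
    ... | i , i≡split , uᵢ≢vᵢ = (λ blocks≡ → rows≢ (cong (λ B → lookup B row) blocks≡)) , (begin
      split _≟Bits_ (blocks s u) (blocks s v) * s ≤⟨ *-monoˡ-≤ s (split≤difference _≟Bits_ (blocks s u) (blocks s v) row rows≢) ⟩
      toℕ row * s                                 ≡⟨ cong (_* s) (FinP.toℕ-fromℕ< i/s<k/s) ⟩
      toℕ i / s * s                               ≤⟨ m/n*n≤m (toℕ i) s ⟩
      toℕ i                                       ≡⟨ i≡split ⟩
      split BoolP._≟_ u v                         ∎)
      where
      open ≤-Reasoning
      i/s<k/s : toℕ i / s < k / s
      i/s<k/s = +s≤⇒/s< (begin
        toℕ i + s           ≤⟨ +-monoʳ-≤ (toℕ i) (subst (λ p → s ≤ k ∸ p) (sym i≡split) s≤k∸split) ⟩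
        toℕ i + (k ∸ toℕ i) ≡⟨ m+[n∸m]≡n (<⇒≤ (FinP.toℕ<n i)) ⟩
        k                   ∎)
      row : Fin (k / s)
      row = fromℕ< i/s<k/s
      rows≢ : lookup (blocks s u) row ≢ lookup (blocks s v) row
      rows≢ = blocks-≢ u v i i/s<k/s uᵢ≢vᵢ

    [r+q*s]/s≡q : ∀ q {r} → r < s → (r + q * s) / s ≡ q
    [r+q*s]/s≡q q {r} r<s = begin
      (r + q * s) / s   ≡⟨ +-distrib-/ r (q * s) r%s+q*s%s<s ⟩
      r / s + q * s / s ≡⟨ cong₂ _+_ (m<n⇒m/n≡0 r<s) (m*n/n≡m q s) ⟩
      q                 ∎
      where
      open ≡-Reasoning
      r%s+q*s%s<s : r % s + q * s % s < s
      r%s+q*s%s<s = subst (_< s) (sym (trans (cong₂ _+_ (m<n⇒m%n≡m r<s) (m*n%n≡0 q s)) (+-identityʳ r))) r<s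

    [r+q*s]%s≡r : ∀ q {r} → r < s → (r + q * s) % s ≡ r
    [r+q*s]%s≡r q {r} r<s = trans ([m+kn]%n≡m%n r q s) (m<n⇒m%n≡m r<s)

    lagSymbol-at : ∀ {c k} (C : Code s c) (y : Vec (Bits (3 * s)) (k / s)) p {j} →
      p / s ≡ suc j → (j<k/s : j < k / s) →
      lagSymbol s C y p ≡ just (lookup (C (lookup y (fromℕ< j<k/s))) (fromℕ< (m%n<n p s)))
    lagSymbol-at {k = k} C y p {j} p/s≡1+j j<k/s with p / s | p/s≡1+j
    ... | .(suc j) | refl with j <? k / s
    ...   | yes j<′ = cong (λ j< → just (lookup (C (lookup y (fromℕ< j<))) (fromℕ< (m%n<n p s)))) (<-irrelevant j<′ j<k/s)
    ...   | no  j≮  = contradiction j<k/s j≮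

    lagSymbol-block : ∀ {c k} (C : Code s c) (y : Vec (Bits (3 * s)) (k / s)) d d′ {j i} →
      j < k / s → i < s →
      lagSymbol s C y (s + (j * s + i)) ≡ just (lookupOr (C (lookupOr y d j)) d′ i)
    lagSymbol-block C y d d′ {j} {i} j<k/s i<s = begin
      lagSymbol s C y p
        ≡⟨ lagSymbol-at C y p (trans (cong (_/ s) p≡i+[1+j]s) ([r+q*s]/s≡q (suc j) i<s)) j<k/s ⟩
      just (lookup (C (lookup y (fromℕ< j<k/s))) (fromℕ< (m%n<n p s)))
        ≡⟨ cong (λ yⱼ → just (lookup (C yⱼ) (fromℕ< (m%n<n p s)))) (lookupOr-fromℕ< y d j<k/s) ⟩
      just (lookup (C (lookupOr y d j)) (fromℕ< (m%n<n p s)))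
        ≡⟨ cong just (lookupOr-fromℕ< (C (lookupOr y d j)) d′ (m%n<n p s)) ⟩
      just (lookupOr (C (lookupOr y d j)) d′ (p % s))
        ≡⟨ cong (λ r → just (lookupOr (C (lookupOr y d j)) d′ r)) (trans (cong (_% s) p≡i+[1+j]s) ([r+q*s]%s≡r (suc j) i<s)) ⟩
      just (lookupOr (C (lookupOr y d j)) d′ i) ∎
      where
      open ≡-Reasoning
      p = s + (j * s + i)
      p≡i+[1+j]s : p ≡ i + suc j * s
      p≡i+[1+j]s = trans (sym (+-assoc s (j * s) i)) (+-comm (s + j * s) i)

    lagSymbols : ∀ {c k} → Code s c → Vec (Bits (3 * s)) (k / s) → Vec (Maybe (Bits c)) k
    lagSymbols C y = tabulate λ q → lagSymbol s C y (suc (toℕ q))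

    block-mismatches : ∀ {c k} (C : Code s c) (y y′ : Vec (Bits (3 * s)) (k / s)) d {j} → j < k / s →
      ∑[ i < s ] mismatch _≟Sym_ (lagSymbol s C y (s + (j * s + i))) (lagSymbol s C y′ (s + (j * s + i)))
        ≡ Δ _≟Bits_ (C (lookupOr y d j)) (C (lookupOr y′ d j))
    block-mismatches {c} C y y′ d {j} j<k/s = begin
      ∑[ i < s ] mismatch _≟Sym_ (lagSymbol s C y (s + (j * s + i))) (lagSymbol s C y′ (s + (j * s + i)))
        ≡⟨ sumBelow-cong s (λ i i<s → trans (cong₂ (mismatch _≟Sym_) (lagSymbol-block C y d d′ j<k/s i<s)
                                                                      (lagSymbol-block C y′ d d′ j<k/s i<s))
                                            (mismatch-just _≟Bits_ _ _)) ⟩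
      ∑[ i < s ] mismatch _≟Bits_ (lookupOr (C (lookupOr y d j)) d′ i) (lookupOr (C (lookupOr y′ d j)) d′ i)
        ≡⟨ Δ-lookupOr _≟Bits_ (C (lookupOr y d j)) (C (lookupOr y′ d j)) d′ ⟨
      Δ _≟Bits_ (C (lookupOr y d j)) (C (lookupOr y′ d j)) ∎
      where
      open ≡-Reasoning
      d′ : Bits c
      d′ = replicate c false

    -- Output position pred s + j s + i (0-indexed), for i < s, carries symbol i of the encoding of tree symbol j.
    code-Δ-≤-Δ-lagSymbols : ∀ {c k} (C : Code s c) (y y′ : Vec (Bits (3 * s)) (k / s)) d {t} → t < k / s →
      ∑[ j < t ] Δ _≟Bits_ (C (lookupOr y d j)) (C (lookupOr y′ d j)) ≤ Δ _≟Sym_ (lagSymbols C y) (lagSymbols C y′)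
    code-Δ-≤-Δ-lagSymbols {k = k} C y y′ d {t} t<k/s = begin
      ∑[ j < t ] Δ _≟Bits_ (C (lookupOr y d j)) (C (lookupOr y′ d j))
        ≡⟨ sumBelow-cong t (λ j j<t → block-mismatches C y y′ d (<-trans j<t t<k/s)) ⟨
      ∑[ j < t ] ∑[ i < s ] mismatchAt (s + (j * s + i))
        ≡⟨ sumBelow-blocks t s (λ q → mismatchAt (s + q)) ⟨
      ∑[ q < t * s ] mismatchAt (s + q)
        ≡⟨ sumBelow-cong (t * s) (λ q _ → cong (λ p → mismatchAt (p + q)) (suc-pred s)) ⟨
      ∑[ q < t * s ] mismatchAt (suc (pred s + q))
        ≤⟨ sumBelow-window (pred s) (t * s) (λ q → mismatchAt (suc q)) window ⟩
      ∑[ q < k ] mismatchAt (suc q)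
        ≡⟨ Δ-tabulate _≟Sym_ k (λ q → lagSymbol s C y (suc q)) (λ q → lagSymbol s C y′ (suc q)) ⟨
      Δ _≟Sym_ (lagSymbols C y) (lagSymbols C y′) ∎
      where
      open ≤-Reasoning
      mismatchAt : ℕ → ℕ
      mismatchAt p = mismatch _≟Sym_ (lagSymbol s C y p) (lagSymbol s C y′ p)
      window : pred s + t * s ≤ k
      window = begin
        pred s + t * s ≤⟨ +-monoˡ-≤ (t * s) (pred[n]≤n {s}) ⟩
        s + t * s      ≤⟨ *-monoˡ-≤ s t<k/s ⟩
        k / s * s      ≤⟨ m/n*n≤m k s ⟩
        k              ∎

    module LaggedPair {c} (C : Code s c) (TC : TruncatedTreeCode s) {k} (k≤ : k ≤ s * s) (u v : Bits k) where

      tree : Bits k → Vec (Bits (3 * s)) (k / s)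
      tree x = TruncatedTreeCode.map TC (div-le s k≤) (blocks s x)

      treeSymbol : Bits k → ℕ → Bits (3 * s)
      treeSymbol x = lookupOr (tree x) (replicate (3 * s) false)

      -- The encoding of the last tree-code symbol may run past position k, so it is not counted.
      treeMismatches : ℕ
      treeMismatches = ∑[ j < pred (k / s) ] mismatch _≟Bits_ (treeSymbol u j) (treeSymbol v j)

      codeDistances : ℕ
      codeDistances = ∑[ j < pred (k / s) ] Δ _≟Bits_ (C (treeSymbol u j)) (C (treeSymbol v j))

      treeMismatches*δs≤codeDistances : ∀ δ → HasRelDistAtLeast C δ →
        ℕtoℚ treeMismatches ℚ.* (δ ℚ.* ℕtoℚ s) ℚ.≤ ℕtoℚ codeDistances
      treeMismatches*δs≤codeDistances δ C-dist = sumBelow-scale-≤ (δ ℚ.* ℕtoℚ s) (pred (k / s)) _ _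
        (λ j _ → mismatch*δs≤Δ-code C δ C-dist (treeSymbol u j) (treeSymbol v j))

      k/s>0 : s ≤ k ∸ split BoolP._≟_ u v → 0 < k / s
      k/s>0 s≤k∸split = m≥n⇒m/n>0 (≤-trans s≤k∸split (m∸n≤m k (split BoolP._≟_ u v)))

      codeDistances≤Δ-Lag : s ≤ k ∸ split BoolP._≟_ u v →
        codeDistances ≤ Δ _≟Sym_ (Lag s C TC k≤ u) (Lag s C TC k≤ v)
      codeDistances≤Δ-Lag s≤k∸split =
        code-Δ-≤-Δ-lagSymbols C (tree u) (tree v) _ (≤-reflexive (suc-pred (k / s) {{>-nonZero (k/s>0 s≤k∸split)}}))

      Δ-tree≤1+treeMismatches : 0 < k / s → Δ _≟Bits_ (tree u) (tree v) ≤ suc treeMismatches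
      Δ-tree≤1+treeMismatches k/s>0 = begin
        Δ _≟Bits_ (tree u) (tree v)                                  ≡⟨ Δ-lookupOr _≟Bits_ (tree u) (tree v) _ ⟩
        ∑[ j < k / s ] treeMismatch j                                ≡⟨ cong (λ n → sumBelow n treeMismatch) k/s≡pred+1 ⟩
        ∑[ j < pred (k / s) + 1 ] treeMismatch j                     ≡⟨ sumBelow-+ (pred (k / s)) 1 treeMismatch ⟩
        treeMismatches + ∑[ j < 1 ] treeMismatch (pred (k / s) + j)  ≤⟨ +-monoʳ-≤ treeMismatches (sumBelow-≤-* 1 _ (λ j →
                                                                          treeMismatch≤1 (pred (k / s) + j))) ⟩
        treeMismatches + 1                                           ≡⟨ +-comm treeMismatches 1 ⟩
        suc treeMismatches                                           ∎
        where
        open ≤-Reasoning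
        treeMismatch : ℕ → ℕ
        treeMismatch j = mismatch _≟Bits_ (treeSymbol u j) (treeSymbol v j)
        treeMismatch≤1 : ∀ j → treeMismatch j ≤ 1
        treeMismatch≤1 j = mismatch≤1 _≟Bits_ (treeSymbol u j) (treeSymbol v j)
        k/s≡pred+1 : k / s ≡ pred (k / s) + 1
        k/s≡pred+1 = trans (sym (suc-pred (k / s) {{>-nonZero k/s>0}})) (+-comm 1 (pred (k / s)))

      length-bound : HasTreeDistAtLeast (TruncatedTreeCode.map TC) ½ → u ≢ v → s ≤ k ∸ split BoolP._≟_ u v →
        k ∸ split BoolP._≟_ u v ≤ (3 + (treeMismatches + treeMismatches)) * s
      length-bound TC-dist u≢v s≤k∸split = <⇒≤ (begin-strict
        k ∸ split BoolP._≟_ u v       <⟨ k∸p<[1+k/s∸j]*s blocksSplit*s≤split (split≤length _≟Bits_ (blocks s u) (blocks s v)) ⟩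
        suc (k / s ∸ blocksSplit) * s ≤⟨ *-monoˡ-≤ s (s≤s (½*-≤⇒≤-double (k / s ∸ blocksSplit) D
                                           (TC-dist (div-le s k≤) (blocks s u) (blocks s v) blocks≢))) ⟩
        suc (D + D) * s               ≤⟨ *-monoˡ-≤ s (s≤s (+-mono-≤ D≤1+N D≤1+N)) ⟩
        suc (suc N + suc N) * s       ≡⟨ cong (λ x → suc (suc x) * s) (+-suc N N) ⟩
        (3 + (N + N)) * s             ∎)
        where
        open ≤-Reasoning
        N D blocksSplit : ℕ
        N = treeMismatches
        D = Δ _≟Bits_ (tree u) (tree v)
        blocksSplit = split _≟Bits_ (blocks s u) (blocks s v)
        D≤1+N : D ≤ suc N
        D≤1+N = Δ-tree≤1+treeMismatches (k/s>0 s≤k∸split)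
        blocks≢ : blocks s u ≢ blocks s v
        blocks≢ = proj₁ (blocks-split-bound u v u≢v s≤k∸split)
        blocksSplit*s≤split : blocksSplit * s ≤ split BoolP._≟_ u v
        blocksSplit*s≤split = proj₂ (blocks-split-bound u v u≢v s≤k∸split)

open LaggedTreeCode

open import Data.Nat using (ℕ; _*_; _≤_; NonZero)
open import Data.Integer using (+_)
open import Data.Rational using (ℚ; 0ℚ; 1ℚ; ½; _/_; _-_; _<_)
import Data.Rational as Q
import Data.Bool.Properties as BoolP
import Data.Nat as ℕ
import Data.Nat.Properties as ℕP
import Data.Rational.Properties as QP
import Data.Rational.Solver
open import Relation.Binary.PropositionalEquality using (cong; refl)

lemma3p5 : (δ : ℚ) → 0ℚ Q.≤ δ → δ < 1ℚ →
           (c : ℕ) → 1 ≤ c →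
           (a : ℕ) .{{_ : NonZero a}} →
           (s : ℕ) .{{_ : NonZero s}} →
           (ℓ : ℚ) → ℕtoℚ (a * s) Q.≤ ℓ →
           (C : Code s c) → HasRelDistAtLeast C δ →
           (TC : TruncatedTreeCode s) → HasTreeDistAtLeast (TruncatedTreeCode.map TC) ½ →
           HasLaggedDistAtLeast s _≟Sym_ (Lag s C TC) ℓ
             (δ Q.* (½ - ((+ 3) / 2) Q.* ((+ 1) / a)))
lemma3p5 δ 0≤δ _ c _ a s ℓ as≤ℓ C C-dist TC TC-dist {k} k≤ u v u≢v ℓ≤m = begin
  δ Q.* ρ Q.* ℕtoℚ m                                   ≡⟨ QP.*-assoc δ ρ (ℕtoℚ m) ⟩
  δ Q.* (ρ Q.* ℕtoℚ m)                                 ≤⟨ QP.*-monoˡ-≤-nonNeg δ {{Q.nonNegative 0≤δ}} (rate-bound a m (s * N) am≤2asN+3m′) ⟩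
  δ Q.* ℕtoℚ (s * N)                                   ≡⟨ cong (δ Q.*_) (ℕtoℚ-* s N) ⟩
  δ Q.* (ℕtoℚ s Q.* ℕtoℚ N)                            ≡⟨ solve 3 (λ δ s N → δ :* (s :* N) := N :* (δ :* s)) refl δ (ℕtoℚ s) (ℕtoℚ N) ⟩
  ℕtoℚ N Q.* (δ Q.* ℕtoℚ s)                            ≤⟨ treeMismatches*δs≤codeDistances δ C-dist ⟩
  ℕtoℚ codeDistances                                   ≤⟨ ℕtoℚ-mono-≤ (codeDistances≤Δ-Lag s≤m) ⟩
  ℕtoℚ (Δ _≟Sym_ (Lag s C TC k≤ u) (Lag s C TC k≤ v))  ∎
  where
  open LaggedPair s C TC k≤ u v
  open QP.≤-Reasoning
  open Data.Rational.Solver.+-*-Solver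
  ρ : ℚ
  ρ = ½ - ((+ 3) / 2) Q.* ((+ 1) / a)
  m N : ℕ
  m = k ℕ.∸ split BoolP._≟_ u v
  N = treeMismatches
  as≤m : a * s ≤ m
  as≤m = ℕtoℚ-cancel-≤ (QP.≤-trans as≤ℓ ℓ≤m)
  s≤m : s ≤ m
  s≤m = ℕP.≤-trans (ℕP.m≤n*m s a) as≤m
  am≤2asN+3m′ : a * m ≤ s * N * (a ℕ.+ a) ℕ.+ 3 * m
  am≤2asN+3m′ = am≤2asN+3m a s m N as≤m (length-bound TC-dist u≢v s≤m)
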